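{- Let $H_1,H_2$ be hyperplanes of $T$ and let $u\in V'$ with $ru\notin H_1\cup H_2$. Then $\{[u+h]: h\in H_1\}=\{[u+f]: f\in H_2\}$.
   Context: Let $e\geq 2$ and let $K$ be a finite commutative ring with identity having precisely three ideals $\{0\}$, $J=\langle r\rangle$, $K$, with $K/J\cong\mathbb{F}_q$ ($q$ a prime power). Let $K^\times$ be the set of units, $V'$ the set of tuples in $K^{2e}$ with at least one entry in $K^\times$, and for $a\in V'$ let $[a]=\{\lambda a:\lambda\in K^\times\}$. Let $T=J^{2e}$; it is a $2e$-dimensional vector space over $K/J$ with scalar multiplication $(z+J)\cdot x=zx$. A hyperplane is a $(2e-1)$-dimensional subspace of $T$. For $u\in K^{2e}$, $ru$ denotes the componentwise product, an element of $T$. -}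

module Defs where

open import Level using (Level; _⊔_)
open import Algebra.Bundles using (CommutativeRing)
open import Data.Nat using (ℕ; zero; suc)
open import Data.Fin using (Fin; zero; suc)
open import Data.Product using (Σ; ∃; ∃-syntax; _×_; _,_)
open import Data.Sum using (_⊎_)
open import Relation.Nullary using (¬_)
open import Data.Unit using (⊤)

module Ring {c ℓ : Level} (R : CommutativeRing c ℓ) where
  open CommutativeRing R hiding (zero)

  PredK : Set (Level.suc (c ⊔ ℓ))
  PredK = Carrier → Set (c ⊔ ℓ)

  _≐_ : PredK → PredK → Set (c ⊔ ℓ)
  A ≐ B = ∀ x → (A x → B x) × (B x → A x)

  Finite : Set (c ⊔ ℓ)
  Finite = ∃[ n ] Σ (Fin n → Carrier) λ enum → ∀ x → ∃[ i ] (enum i ≈ x)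

  record IsIdeal (I : PredK) : Set (c ⊔ ℓ) where
    field
      resp     : ∀ {x y} → x ≈ y → I x → I y
      zero∈    : I 0#
      +-closed : ∀ {x y} → I x → I y → I (x + y)
      -closed  : ∀ {x} → I x → I (- x)
      *-closed : ∀ k {x} → I x → I (k * x)

  ZeroIdeal : PredK
  ZeroIdeal x = Level.Lift (c ⊔ ℓ) (x ≈ 0#)

  FullIdeal : PredK
  FullIdeal x = Level.Lift (c ⊔ ℓ) ⊤

  ⟨_⟩ : Carrier → PredK
  ⟨ r ⟩ x = ∃[ k ] (x ≈ k * r)

  ExactlyThreeIdeals : Carrier → Set (Level.suc (c ⊔ ℓ))
  ExactlyThreeIdeals r =
    (¬ (ZeroIdeal ≐ ⟨ r ⟩)) × (¬ (⟨ r ⟩ ≐ FullIdeal)) × (¬ (ZeroIdeal ≐ FullIdeal)) ×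
    (∀ (I : PredK) → IsIdeal I → (I ≐ ZeroIdeal) ⊎ (I ≐ ⟨ r ⟩) ⊎ (I ≐ FullIdeal))

  IsUnit : Carrier → Set (c ⊔ ℓ)
  IsUnit x = ∃[ y ] (x * y ≈ 1#)

  Vec : ℕ → Set c
  Vec n = Fin n → Carrier

  _≈ᵥ_ : ∀ {n} → Vec n → Vec n → Set ℓ
  a ≈ᵥ b = ∀ i → a i ≈ b i

  _+ᵥ_ : ∀ {n} → Vec n → Vec n → Vec n
  (a +ᵥ b) i = a i + b i

  _·_ : ∀ {n} → Carrier → Vec n → Vec n
  (z · a) i = z * a i

  0ᵥ : ∀ {n} → Vec n
  0ᵥ i = 0#

  lincomb : ∀ {n} (m : ℕ) → (Fin m → Carrier) → (Fin m → Vec n) → Vec n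
  lincomb zero    cs bs = 0ᵥ
  lincomb (suc m) cs bs = (cs zero · bs zero) +ᵥ lincomb m (λ i → cs (suc i)) (λ i → bs (suc i))

  InV' : ∀ {n} → Vec n → Set (c ⊔ ℓ)
  InV' a = ∃[ i ] IsUnit (a i)

  -- the class [a] = { λ a : λ ∈ K^× }, as a subset of K^n
  Cls : ∀ {n} → Vec n → Vec n → Set (c ⊔ ℓ)
  Cls a x = ∃[ λ′ ] (IsUnit λ′ × (x ≈ᵥ (λ′ · a)))

  _≐ᶜ_ : ∀ {n} → (Vec n → Set (c ⊔ ℓ)) → (Vec n → Set (c ⊔ ℓ)) → Set (c ⊔ ℓ)
  A ≐ᶜ B = ∀ x → (A x → B x) × (B x → A x)

  PredV : ℕ → Set (Level.suc (c ⊔ ℓ))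
  PredV n = Vec n → Set (c ⊔ ℓ)

  -- T = J^n where J = ⟨ r ⟩
  InT : Carrier → ∀ {n} → Vec n → Set (c ⊔ ℓ)
  InT r a = ∀ i → ⟨ r ⟩ (a i)

  -- S is a (K/J)-subspace of T, scalar multiplication (z + J)·x = z x
  record IsSubspace (r : Carrier) {n : ℕ} (S : PredV n) : Set (c ⊔ ℓ) where
    field
      resp     : ∀ {x y} → x ≈ᵥ y → S x → S y
      ⊆T       : ∀ {x} → S x → InT r x
      zero∈    : S 0ᵥ
      +-closed : ∀ {x y} → S x → S y → S (x +ᵥ y)
      ·-closed : ∀ z {x} → S x → S (z · x)

  -- S has dimension d over K/J: a basis b_0..b_{d-1} of S, linearly independent
  -- over K/J (coefficients are representatives in K, zero in K/J iff in J)
  HasDim : (r : Carrier) {n : ℕ} → PredV n → ℕ → Set (c ⊔ ℓ)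
  HasDim r {n} S d = Σ (Fin d → Vec n) λ b →
    (∀ i → S (b i)) ×
    (∀ (cs : Fin d → Carrier) → lincomb d cs b ≈ᵥ 0ᵥ → ∀ i → ⟨ r ⟩ (cs i)) ×
    (∀ x → S x → ∃[ cs ] (x ≈ᵥ lincomb d cs b))

  IsHyperplane : (r : Carrier) (n : ℕ) → PredV n → Set (c ⊔ ℓ)
  IsHyperplane r n H = IsSubspace r H × HasDim r H (n Data.Nat.∸ 1)

{-# OPTIONS --safe #-}
-- K is a local ring whose maximal ideal J = ⟨ r ⟩ squares to zero, so every element is a unit
-- or lies in J. Any n + 1 vectors of T = J^n are dependent over K/J (Gaussian elimination),
-- hence a hyperplane H together with any w ∈ T ∖ H spans T. For h ∈ H₁ write
-- h = f + k (r u) with f ∈ H₂; since (k r) h ∈ J² = 0 we get (1 - k r)(u + h) = u + f, and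
-- 1 - k r is a unit, so [u + h] = [u + f].
module Submission where

open import Defs
open import Level using (Level; _⊔_; lift; lower)
open import Algebra.Bundles using (CommutativeRing)
open import Data.Nat using (ℕ; zero; suc; _≤_; s≤s)
open import Data.Nat.Properties using (≤-refl)
open import Data.Fin using (Fin; zero; suc; punchIn)
open import Data.Fin.Properties using (any?)
open import Data.Vec.Functional using (insertAt; _∷_)
open import Data.Vec.Functional.Properties using (insertAt-lookup; insertAt-punchIn; removeAt-insertAt)
open import Data.Product using (∃-syntax; _×_; _,_; proj₁; proj₂)
open import Data.Sum using (_⊎_; inj₁; inj₂; [_,_]′)
open import Data.Empty using (⊥; ⊥-elim)
open import Data.Unit using (tt)
open import Relation.Nullary using (¬_; Dec; yes; no)
open import Relation.Nullary.Decidable using (¬?; decidable-stable)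
open import Relation.Binary.PropositionalEquality using (_≡_)
import Relation.Binary.PropositionalEquality as ≡
import Algebra.Properties.Ring as RingProperties
import Algebra.Properties.Group as GroupProperties
import Algebra.Properties.CommutativeSemigroup as CommutativeSemigroupProperties
import Algebra.Properties.Semiring.Sum as SemiringSum
import Relation.Binary.Reasoning.Setoid as SetoidReasoning

module _ {c ℓ : Level} (R : CommutativeRing c ℓ) where
  open CommutativeRing R hiding (zero)
  open Defs.Ring R
  open RingProperties ring using (-‿distribˡ-*; -‿distribʳ-*; [y-z]x≈yx-zx)
  open GroupProperties +-group using (inverseˡ-unique; //-rightDividesˡ; //-rightDividesʳ; x≈y⇒x∙y⁻¹≈ε)
  open CommutativeSemigroupProperties *-commutativeSemigroup using (xy∙z≈xz∙y; interchange)
  open SemiringSum semiring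
    using (sum-syntax; sum-remove; ∑-distrib-+; *-distribʳ-sum; sum-cong-≋; sum-cong-≗; sum-replicate-zero)
  open SetoidReasoning setoid

  ⟨⟩-isIdeal : ∀ a → IsIdeal ⟨ a ⟩
  ⟨⟩-isIdeal a = record
    { resp     = λ { x≈y (k , x≈ka) → k , trans (sym x≈y) x≈ka }
    ; zero∈    = 0# , sym (zeroˡ a)
    ; +-closed = λ { (k , p) (l , q) → k + l , trans (+-cong p q) (sym (distribʳ a k l)) }
    ; -closed  = λ { (k , p) → - k , trans (-‿cong p) (-‿distribˡ-* k a) }
    ; *-closed = λ { k (l , p) → k * l , trans (*-congˡ p) (sym (*-assoc k l a)) }
    }

  a∈⟨a⟩ : ∀ a → ⟨ a ⟩ a
  a∈⟨a⟩ a = 1# , sym (*-identityˡ a)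

  ⟨0⟩≈0 : ∀ {a b} → a ≈ 0# → ⟨ a ⟩ b → b ≈ 0#
  ⟨0⟩≈0 {a} a≈0 (k , b≈ka) = trans b≈ka (trans (*-congˡ a≈0) (zeroʳ k))

  isUnit-* : ∀ {x y} → IsUnit x → IsUnit y → IsUnit (x * y)
  isUnit-* {x} {y} (x′ , xx′≈1) (y′ , yy′≈1) =
    x′ * y′ , trans (interchange x y x′ y′) (trans (*-cong xx′≈1 yy′≈1) (*-identityˡ 1#))

  u*v≈1⇒v*[u*x]≈x : ∀ {u v} → u * v ≈ 1# → ∀ x → v * (u * x) ≈ x
  u*v≈1⇒v*[u*x]≈x {u} {v} uv≈1 x = begin
    v * (u * x)  ≈⟨ *-assoc v u x ⟨
    (v * u) * x  ≈⟨ *-congʳ (trans (*-comm v u) uv≈1) ⟩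
    1# * x       ≈⟨ *-identityˡ x ⟩
    x            ∎

  isUnit*x≈0⇒x≈0 : ∀ {u x} → IsUnit u → u * x ≈ 0# → x ≈ 0#
  isUnit*x≈0⇒x≈0 {u} {x} (v , uv≈1) ux≈0 = begin
    x            ≈⟨ u*v≈1⇒v*[u*x]≈x uv≈1 x ⟨
    v * (u * x)  ≈⟨ *-congˡ ux≈0 ⟩
    v * 0#       ≈⟨ zeroʳ v ⟩
    0#           ∎

  u*x+l≈0⇒x≈-v*l : ∀ {u v x l} → u * v ≈ 1# → u * x + l ≈ 0# → x ≈ (- v) * l
  u*x+l≈0⇒x≈-v*l {u} {v} {x} {l} uv≈1 ux+l≈0 = begin
    x            ≈⟨ u*v≈1⇒v*[u*x]≈x uv≈1 x ⟨
    v * (u * x)  ≈⟨ *-congˡ (inverseˡ-unique (u * x) l ux+l≈0) ⟩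
    v * (- l)    ≈⟨ -‿distribʳ-* v l ⟨
    - (v * l)    ≈⟨ -‿distribˡ-* v l ⟩
    (- v) * l    ∎

  Cls-≐ᶜ : ∀ {n} {a b : Vec n} {μ} → IsUnit μ → b ≈ᵥ (μ · a) → Cls a ≐ᶜ Cls b
  Cls-≐ᶜ {a = a} {b} {μ} (μ′ , μμ′≈1) b≈μa z = a⇒b , b⇒a
    where
    a⇒b : Cls a z → Cls b z
    a⇒b (ν , ν-unit , z≈νa) = ν * μ′ , isUnit-* ν-unit (μ , trans (*-comm μ′ μ) μμ′≈1) , λ t → begin
      z t                   ≈⟨ z≈νa t ⟩
      ν * a t               ≈⟨ *-congˡ (u*v≈1⇒v*[u*x]≈x μμ′≈1 (a t)) ⟨
      ν * (μ′ * (μ * a t))  ≈⟨ *-assoc ν μ′ (μ * a t) ⟨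
      (ν * μ′) * (μ * a t)  ≈⟨ *-congˡ (b≈μa t) ⟨
      (ν * μ′) * b t        ∎

    b⇒a : Cls b z → Cls a z
    b⇒a (ν , ν-unit , z≈νb) = ν * μ , isUnit-* ν-unit (μ′ , μμ′≈1) ,
      λ t → trans (z≈νb t) (trans (*-congˡ (b≈μa t)) (sym (*-assoc ν μ (a t))))

  lincomb-∈ : ∀ {r n} {H : PredV n} → IsSubspace r H →
              ∀ m cs (bs : Fin m → Vec n) → (∀ i → H (bs i)) → H (lincomb m cs bs)
  lincomb-∈ H-sub zero    cs bs bs∈H = IsSubspace.zero∈ H-sub
  lincomb-∈ H-sub (suc m) cs bs bs∈H =
    IsSubspace.+-closed H-sub (IsSubspace.·-closed H-sub (cs zero) (bs∈H zero))
                              (lincomb-∈ H-sub m _ _ (λ i → bs∈H (suc i)))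

  lincomb≡∑ : ∀ {n} m cs (bs : Fin m → Vec n) t → lincomb m cs bs t ≡ ∑[ i < m ] (cs i * bs i t)
  lincomb≡∑ zero    cs bs t = ≡.refl
  lincomb≡∑ (suc m) cs bs t = ≡.cong (cs zero * bs zero t +_) (lincomb≡∑ m _ _ t)

  lincomb-insertAt : ∀ {m n} cs (p : Fin (suc m)) c (v : Fin (suc m) → Vec n) t →
                     lincomb (suc m) (insertAt cs p c) v t ≈ c * v p t + lincomb m cs (λ j → v (punchIn p j)) t
  lincomb-insertAt {m} cs p c v t = begin
    lincomb (suc m) (insertAt cs p c) v t
      ≡⟨ lincomb≡∑ (suc m) (insertAt cs p c) v t ⟩
    ∑[ i < suc m ] (insertAt cs p c i * v i t)
      ≈⟨ sum-remove {i = p} (λ i → insertAt cs p c i * v i t) ⟩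
    insertAt cs p c p * v p t + ∑[ j < m ] (insertAt cs p c (punchIn p j) * v (punchIn p j) t)
      ≡⟨ ≡.cong₂ _+_ (≡.cong (_* v p t) (insertAt-lookup cs p c))
                     (sum-cong-≗ (λ j → ≡.cong (_* v (punchIn p j) t) (removeAt-insertAt cs p c j))) ⟩
    c * v p t + ∑[ j < m ] (cs j * v (punchIn p j) t)
      ≡⟨ ≡.cong (c * v p t +_) (lincomb≡∑ m cs (λ j → v (punchIn p j)) t) ⟨
    c * v p t + lincomb m cs (λ j → v (punchIn p j)) t
      ∎

  -- Dependence over K/J: in the local ring K, an element is nonzero in K/J iff it is a unit.
  IsDependent : ∀ {m n} → (Fin m → Vec n) → Set (c ⊔ ℓ)
  IsDependent {m} v = ∃[ cs ] (lincomb m cs v ≈ᵥ 0ᵥ × ∃[ i ] IsUnit (cs i))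

  eliminate : ∀ {m n} → (Fin (suc m) → Vec n) → (p : Fin (suc m)) → (Fin (suc m) → Carrier) → Fin m → Vec n
  eliminate v p k j t = v (punchIn p j) t - k (punchIn p j) * v p t

  lincomb-eliminate : ∀ {m n} (v : Fin (suc m) → Vec n) p k cs t →
    lincomb m cs (λ j → v (punchIn p j)) t
      ≈ lincomb m cs (eliminate v p k) t + (∑[ j < m ] (cs j * k (punchIn p j))) * v p t
  lincomb-eliminate {m} v p k cs t = begin
    lincomb m cs (λ j → v (punchIn p j)) t
      ≡⟨ lincomb≡∑ m cs _ t ⟩
    ∑[ j < m ] (cs j * y j)
      ≈⟨ sum-cong-≋ split ⟩
    ∑[ j < m ] (cs j * eliminate v p k j t + (cs j * k (punchIn p j)) * x)
      ≈⟨ ∑-distrib-+ (λ j → cs j * eliminate v p k j t) (λ j → (cs j * k (punchIn p j)) * x) ⟩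
    ∑[ j < m ] (cs j * eliminate v p k j t) + ∑[ j < m ] ((cs j * k (punchIn p j)) * x)
      ≈⟨ +-cong (reflexive (≡.sym (lincomb≡∑ m cs (eliminate v p k) t)))
                (sym (*-distribʳ-sum x (λ j → cs j * k (punchIn p j)))) ⟩
    lincomb m cs (eliminate v p k) t + (∑[ j < m ] (cs j * k (punchIn p j))) * x
      ∎
    where
    x : Carrier
    x = v p t
    y : Fin m → Carrier
    y j = v (punchIn p j) t

    split : ∀ j → cs j * y j ≈ cs j * eliminate v p k j t + (cs j * k (punchIn p j)) * x
    split j = begin
      cs j * y j                                            ≈⟨ *-congˡ (//-rightDividesˡ (k (punchIn p j) * x) (y j)) ⟨
      cs j * (eliminate v p k j t + k (punchIn p j) * x)    ≈⟨ distribˡ (cs j) _ _ ⟩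
      cs j * eliminate v p k j t + cs j * (k (punchIn p j) * x) ≈⟨ +-congˡ (*-assoc (cs j) _ x) ⟨
      cs j * eliminate v p k j t + (cs j * k (punchIn p j)) * x ∎

  dependent-by-elimination : ∀ {m n} (v : Fin (suc m) → Vec (suc n)) p k →
    (∀ i → v i zero ≈ k i * v p zero) →
    IsDependent (λ j t → eliminate v p k j (suc t)) → IsDependent v
  dependent-by-elimination {m} v p k column (cs , tail-relation , j , cs-unit) =
    insertAt cs p (- K) , relation , punchIn p j ,
    ≡.subst IsUnit (≡.sym (insertAt-punchIn cs p (- K) j)) cs-unit
    where
    K : Carrier
    K = ∑[ j < m ] (cs j * k (punchIn p j))

    pivot-column-cleared : ∀ j → eliminate v p k j zero ≈ 0#
    pivot-column-cleared j = x≈y⇒x∙y⁻¹≈ε (column (punchIn p j))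

    eliminated-relation : lincomb m cs (eliminate v p k) ≈ᵥ 0ᵥ
    eliminated-relation zero = begin
      lincomb m cs (eliminate v p k) zero       ≡⟨ lincomb≡∑ m cs (eliminate v p k) zero ⟩
      ∑[ j < m ] (cs j * eliminate v p k j zero) ≈⟨ sum-cong-≋ (λ j → trans (*-congˡ (pivot-column-cleared j)) (zeroʳ (cs j))) ⟩
      ∑[ j < m ] 0#                              ≈⟨ sum-replicate-zero m ⟩
      0#                                         ∎
    eliminated-relation (suc t) =
      trans (reflexive (≡.trans (lincomb≡∑ m cs (eliminate v p k) (suc t))
                                (≡.sym (lincomb≡∑ m cs (λ j t → eliminate v p k j (suc t)) t))))
            (tail-relation t)

    relation : lincomb (suc m) (insertAt cs p (- K)) v ≈ᵥ 0ᵥ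
    relation t = begin
      lincomb (suc m) (insertAt cs p (- K)) v t                        ≈⟨ lincomb-insertAt cs p (- K) v t ⟩
      - K * v p t + lincomb m cs (λ j → v (punchIn p j)) t             ≈⟨ +-congˡ (lincomb-eliminate v p k cs t) ⟩
      - K * v p t + (lincomb m cs (eliminate v p k) t + K * v p t)     ≈⟨ +-congˡ (+-congʳ (eliminated-relation t)) ⟩
      - K * v p t + (0# + K * v p t)                                   ≈⟨ +-congˡ (+-identityˡ (K * v p t)) ⟩
      - K * v p t + K * v p t                                          ≈⟨ +-congʳ (-‿distribˡ-* K (v p t)) ⟨
      - (K * v p t) + K * v p t                                        ≈⟨ -‿inverseˡ (K * v p t) ⟩
      0#                                                               ∎

  module _ {r : Carrier} (three : ExactlyThreeIdeals r) where

    principal-ideal-cases : ∀ a → (⟨ a ⟩ ≐ ZeroIdeal) ⊎ (⟨ a ⟩ ≐ ⟨ r ⟩) ⊎ (⟨ a ⟩ ≐ FullIdeal)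
    principal-ideal-cases a = proj₂ (proj₂ (proj₂ three)) ⟨ a ⟩ (⟨⟩-isIdeal a)

    r≉0 : ¬ r ≈ 0#
    r≉0 r≈0 = proj₁ three (λ x → (λ x≈0 → 0# , trans (lower x≈0) (sym (zeroˡ r))) ,
                                 (λ x∈J → lift (⟨0⟩≈0 r≈0 x∈J)))

    1∉J : ¬ ⟨ r ⟩ 1#
    1∉J (k , 1≈kr) = proj₁ (proj₂ three) (λ y → (λ _ → lift tt) , λ _ → y * k , (begin
      y              ≈⟨ *-identityʳ y ⟨
      y * 1#         ≈⟨ *-congˡ 1≈kr ⟩
      y * (k * r)    ≈⟨ *-assoc y k r ⟨
      (y * k) * r    ∎))

    isUnit⇒∉J : ∀ {x} → IsUnit x → ¬ ⟨ r ⟩ x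
    isUnit⇒∉J {x} (y , xy≈1) (k , x≈kr) =
      1∉J (k * y , trans (sym xy≈1) (trans (*-congʳ x≈kr) (xy∙z≈xz∙y k r y)))

    isUnit⊎∈J : ∀ x → IsUnit x ⊎ ⟨ r ⟩ x
    isUnit⊎∈J x with principal-ideal-cases x
    ... | inj₁ ⟨x⟩≐0        = inj₂ (0# , trans (lower (proj₁ (⟨x⟩≐0 x) (a∈⟨a⟩ x))) (sym (zeroˡ r)))
    ... | inj₂ (inj₁ ⟨x⟩≐J) = inj₂ (proj₁ (⟨x⟩≐J x) (a∈⟨a⟩ x))
    ... | inj₂ (inj₂ ⟨x⟩≐K) with proj₂ (⟨x⟩≐K 1#) (lift tt)
    ...   | k , 1≈kx = inj₁ (k , trans (*-comm x k) (sym 1≈kx))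

    1-∈J-isUnit : ∀ {a} → ⟨ r ⟩ a → IsUnit (1# - a)
    1-∈J-isUnit {a} a∈J with isUnit⊎∈J (1# - a)
    ... | inj₁ unit = unit
    ... | inj₂ 1-a∈J = ⊥-elim (1∉J (IsIdeal.resp (⟨⟩-isIdeal r) (//-rightDividesˡ a 1#)
                                     (IsIdeal.+-closed (⟨⟩-isIdeal r) 1-a∈J a∈J)))

    x≈a*x⇒x≈0 : ∀ {a x} → ⟨ r ⟩ a → x ≈ a * x → x ≈ 0#
    x≈a*x⇒x≈0 {a} {x} a∈J x≈ax = isUnit*x≈0⇒x≈0 (1-∈J-isUnit a∈J) (begin
      (1# - a) * x       ≈⟨ [y-z]x≈yx-zx x 1# a ⟩
      1# * x - a * x     ≈⟨ +-congʳ (*-identityˡ x) ⟩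
      x - a * x          ≈⟨ x≈y⇒x∙y⁻¹≈ε x≈ax ⟩
      0#                 ∎)

    r*r≈0 : r * r ≈ 0#
    r*r≈0 with principal-ideal-cases (r * r)
    ... | inj₁ ⟨rr⟩≐0        = lower (proj₁ (⟨rr⟩≐0 (r * r)) (a∈⟨a⟩ (r * r)))
    ... | inj₂ (inj₁ ⟨rr⟩≐J) with proj₂ (⟨rr⟩≐J r) (a∈⟨a⟩ r)
    ...   | k , r≈k[rr] = ⊥-elim (r≉0 (x≈a*x⇒x≈0 (k , refl) (trans r≈k[rr] (sym (*-assoc k r r)))))
    r*r≈0 | inj₂ (inj₂ ⟨rr⟩≐K) with proj₂ (⟨rr⟩≐K 1#) (lift tt)
    ...   | k , 1≈k[rr] = ⊥-elim (1∉J (k * r , trans 1≈k[rr] (sym (*-assoc k r r))))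

    ∈J*∈J≈0 : ∀ {a b} → ⟨ r ⟩ a → ⟨ r ⟩ b → a * b ≈ 0#
    ∈J*∈J≈0 (k , a≈kr) (l , b≈lr) =
      trans (*-cong a≈kr b≈lr) (trans (interchange k r l r) (trans (*-congˡ r*r≈0) (zeroʳ (k * l))))

    ≈0? : ∀ x → Dec (x ≈ 0#)
    ≈0? x with principal-ideal-cases x
    ... | inj₁ ⟨x⟩≐0        = yes (lower (proj₁ (⟨x⟩≐0 x) (a∈⟨a⟩ x)))
    ... | inj₂ (inj₁ ⟨x⟩≐J) = no (λ x≈0 → r≉0 (⟨0⟩≈0 x≈0 (proj₂ (⟨x⟩≐J r) (a∈⟨a⟩ r))))
    ... | inj₂ (inj₂ ⟨x⟩≐K) = no (λ x≈0 → r≉0 (⟨0⟩≈0 x≈0 (proj₂ (⟨x⟩≐K r) (lift tt))))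

    ∈J⇒∈⟨≉0⟩ : ∀ {a b} → ¬ a ≈ 0# → ⟨ r ⟩ b → ⟨ a ⟩ b
    ∈J⇒∈⟨≉0⟩ {a} {b} a≉0 b∈J with principal-ideal-cases a
    ... | inj₁ ⟨a⟩≐0        = ⊥-elim (a≉0 (lower (proj₁ (⟨a⟩≐0 a) (a∈⟨a⟩ a))))
    ... | inj₂ (inj₁ ⟨a⟩≐J) = proj₂ (⟨a⟩≐J b) b∈J
    ... | inj₂ (inj₂ ⟨a⟩≐K) = proj₂ (⟨a⟩≐K b) (lift tt)

    J-pivot : ∀ {m} (a : Fin (suc m) → Carrier) → (∀ i → ⟨ r ⟩ (a i)) → ∃[ p ] (∀ i → ⟨ a p ⟩ (a i))
    J-pivot a a∈J with any? (λ i → ¬? (≈0? (a i)))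
    ... | yes (p , ap≉0) = p , λ i → ∈J⇒∈⟨≉0⟩ ap≉0 (a∈J i)
    ... | no all≈0       = zero , λ i → 0# , trans (a≈0 i) (sym (zeroˡ (a zero)))
      where
      a≈0 : ∀ i → a i ≈ 0#
      a≈0 i = decidable-stable (≈0? (a i)) (λ ai≉0 → all≈0 (i , ai≉0))

    J^n-dependent : ∀ {n m} → n ≤ m → (v : Fin (suc m) → Vec n) → (∀ i → InT r (v i)) → IsDependent v
    J^n-dependent {zero}  _         v _   = (λ _ → 1#) , (λ ()) , zero , 1# , *-identityʳ 1#
    J^n-dependent {suc n} (s≤s n≤m) v v∈T with J-pivot (λ i → v i zero) (λ i → v∈T i zero)
    ... | p , column = dependent-by-elimination v p k (λ i → proj₂ (column i))
                         (J^n-dependent n≤m (λ j t → eliminate v p k j (suc t)) eliminated∈T)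
      where
      k : Fin _ → Carrier
      k i = proj₁ (column i)

      eliminated∈T : ∀ j → InT r (λ t → eliminate v p k j (suc t))
      eliminated∈T j t = +-closed (v∈T _ _) (-closed (*-closed _ (v∈T p (suc t))))
        where open IsIdeal (⟨⟩-isIdeal r)

    hyperplane-split : ∀ {n} {H : PredV (suc n)} → IsSubspace r H → HasDim r H n →
                       ∀ {w} → InT r w → ¬ H w →
                       ∀ {x} → InT r x → ∃[ k ] ∃[ s ] (H s × x ≈ᵥ (s +ᵥ (k · w)))
    hyperplane-split {n} {H} H-sub (b , b∈H , b-independent , _) {w} w∈T w∉H {x} x∈T =
      split (J^n-dependent ≤-refl (x ∷ w ∷ b) family∈T)
      where
      family∈T : ∀ i → InT r ((x ∷ w ∷ b) i)
      family∈T zero          = x∈T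
      family∈T (suc zero)    = w∈T
      family∈T (suc (suc i)) = IsSubspace.⊆T H-sub (b∈H i)

      split : IsDependent (x ∷ w ∷ b) → ∃[ k ] ∃[ s ] (H s × x ≈ᵥ (s +ᵥ (k · w)))
      split (cs , relation , i , cs-unit) =
        [ c₀-unit⇒split , (λ c₀∈J → ⊥-elim (c₀∈J⇒⊥ c₀∈J)) ]′ (isUnit⊎∈J c₀)
        where
        c₀ c₁ : Carrier
        c₀ = cs zero
        c₁ = cs (suc zero)
        L : Vec (suc n)
        L = lincomb n (λ j → cs (suc (suc j))) b
        L∈H : H L
        L∈H = lincomb-∈ H-sub n _ b b∈H

        c₀-unit⇒split : IsUnit c₀ → ∃[ k ] ∃[ s ] (H s × x ≈ᵥ (s +ᵥ (k · w)))
        c₀-unit⇒split (y , c₀y≈1) = - (y * c₁) , (- y) · L , IsSubspace.·-closed H-sub (- y) L∈H , λ t → begin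
          x t                              ≈⟨ u*x+l≈0⇒x≈-v*l c₀y≈1 (relation t) ⟩
          (- y) * (c₁ * w t + L t)         ≈⟨ distribˡ (- y) (c₁ * w t) (L t) ⟩
          (- y) * (c₁ * w t) + (- y) * L t ≈⟨ +-comm _ _ ⟩
          (- y) * L t + (- y) * (c₁ * w t) ≈⟨ +-congˡ (*-assoc (- y) c₁ (w t)) ⟨
          (- y) * L t + ((- y) * c₁) * w t ≈⟨ +-congˡ (*-congʳ (-‿distribˡ-* y c₁)) ⟨
          (- y) * L t + (- (y * c₁)) * w t ∎

        c₀∈J⇒⊥ : ⟨ r ⟩ c₀ → ⊥
        c₀∈J⇒⊥ c₀∈J = [ c₁-unit⇒⊥ , c₁∈J⇒⊥ ]′ (isUnit⊎∈J c₁)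
          where
          c₁w+L≈0 : ∀ t → c₁ * w t + L t ≈ 0#
          c₁w+L≈0 t = trans (sym (+-identityˡ _)) (trans (+-congʳ (sym (∈J*∈J≈0 c₀∈J (x∈T t)))) (relation t))

          c₁-unit⇒⊥ : IsUnit c₁ → ⊥
          c₁-unit⇒⊥ (y , c₁y≈1) =
            w∉H (IsSubspace.resp H-sub (λ t → sym (u*x+l≈0⇒x≈-v*l c₁y≈1 (c₁w+L≈0 t)))
                                       (IsSubspace.·-closed H-sub (- y) L∈H))

          c₁∈J⇒⊥ : ⟨ r ⟩ c₁ → ⊥
          c₁∈J⇒⊥ c₁∈J = isUnit⇒∉J cs-unit (cs∈J i)
            where
            L≈0 : L ≈ᵥ 0ᵥ
            L≈0 t = trans (sym (+-identityˡ _)) (trans (+-congʳ (sym (∈J*∈J≈0 c₁∈J (w∈T t)))) (c₁w+L≈0 t))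

            cs∈J : ∀ i → ⟨ r ⟩ (cs i)
            cs∈J zero          = c₀∈J
            cs∈J (suc zero)    = c₁∈J
            cs∈J (suc (suc j)) = b-independent _ L≈0 j

    translate-class : ∀ {n} {H₁ H₂ : PredV (suc n)} {u : Vec (suc n)} →
                      IsSubspace r H₁ → IsSubspace r H₂ → HasDim r H₂ n → ¬ H₂ (r · u) →
                      ∀ h → H₁ h → ∃[ f ] (H₂ f × (Cls (u +ᵥ h) ≐ᶜ Cls (u +ᵥ f)))
    translate-class {H₂ = H₂} {u} H₁-sub H₂-sub H₂-dim ru∉H₂ h h∈H₁ =
      translate (hyperplane-split H₂-sub H₂-dim ru∈T ru∉H₂ h∈T)
      where
      h∈T : InT r h
      h∈T = IsSubspace.⊆T H₁-sub h∈H₁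

      ru∈T : InT r (r · u)
      ru∈T t = u t , *-comm r (u t)

      translate : ∃[ k ] ∃[ f ] (H₂ f × h ≈ᵥ (f +ᵥ (k · (r · u)))) →
                  ∃[ f ] (H₂ f × (Cls (u +ᵥ h) ≐ᶜ Cls (u +ᵥ f)))
      translate (k , f , f∈H₂ , h≈f+k[ru]) = f , f∈H₂ , Cls-≐ᶜ (1-∈J-isUnit (k , refl)) u+f≈[1-kr][u+h]
        where
        u+f≈[1-kr][u+h] : (u +ᵥ f) ≈ᵥ ((1# - k * r) · (u +ᵥ h))
        u+f≈[1-kr][u+h] t = sym (begin
          (1# - k * r) * (u t + h t)                      ≈⟨ [y-z]x≈yx-zx (u t + h t) 1# (k * r) ⟩
          1# * (u t + h t) - (k * r) * (u t + h t)        ≈⟨ +-cong (*-identityˡ _) (-‿cong (distribˡ (k * r) (u t) (h t))) ⟩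
          (u t + h t) - ((k * r) * u t + (k * r) * h t)   ≈⟨ +-congˡ (-‿cong (+-cong (*-assoc k r (u t)) krh≈0)) ⟩
          (u t + h t) - (k * (r * u t) + 0#)              ≈⟨ +-congˡ (-‿cong (+-identityʳ _)) ⟩
          (u t + h t) - k * (r * u t)                     ≈⟨ +-assoc (u t) (h t) _ ⟩
          u t + (h t - k * (r * u t))                     ≈⟨ +-congˡ (+-congʳ (h≈f+k[ru] t)) ⟩
          u t + ((f t + k * (r * u t)) - k * (r * u t))   ≈⟨ +-congˡ (//-rightDividesʳ (k * (r * u t)) (f t)) ⟩
          u t + f t                                       ∎)
          where
          krh≈0 : (k * r) * h t ≈ 0#
          krh≈0 = ∈J*∈J≈0 (k , refl) (h∈T t)

open import Data.Nat using (_*_)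

lemma3p5 : ∀ {c ℓ : Level} (R : CommutativeRing c ℓ) →
    let open Defs.Ring R in
    Finite → (r : CommutativeRing.Carrier R) → ExactlyThreeIdeals r →
    (e : ℕ) → 2 ≤ e →
    (H₁ H₂ : PredV (2 * e)) → IsHyperplane r (2 * e) H₁ → IsHyperplane r (2 * e) H₂ →
    (u : Vec (2 * e)) → InV' u → ¬ H₁ (r · u) → ¬ H₂ (r · u) →
    ((∀ h → H₁ h → ∃[ f ] (H₂ f × (Cls (u +ᵥ h) ≐ᶜ Cls (u +ᵥ f)))) ×
     (∀ f → H₂ f → ∃[ h ] (H₁ h × (Cls (u +ᵥ f) ≐ᶜ Cls (u +ᵥ h)))))
lemma3p5 R _ r three zero ()
lemma3p5 R _ r three (suc e) _ H₁ H₂ (H₁-sub , H₁-dim) (H₂-sub , H₂-dim) u _ ru∉H₁ ru∉H₂ =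
  translate-class R three H₁-sub H₂-sub H₂-dim ru∉H₂ ,
  translate-class R three H₂-sub H₁-sub H₁-dim ru∉H₁
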